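{- Let $G=(S,T;E)$ with $S=\{s_1,\dots,s_n\}$, $T=\{t_1,\dots,t_k\}$ and $d\in\mathbb Z_+$. Consider the algorithm $S$-Greedy: start with $M=\emptyset$; for $i=1,\dots,n$, if there is an edge $s_it_j\in E$ such that $M\cup\{s_it_j\}$ is a $d$-distance matching, add to $M$ such an edge with the smallest index $j$; output $M$. Then the output $M$ is a $d$-distance matching with $2|M|\ge|M^*|$ for every $d$-distance matching $M^*$ of $G$; i.e., $S$-Greedy is a $2$-approximation algorithm for the maximum-cardinality $d$-distance matching problem.
   Context: $G$ is a finite bipartite graph without loops or parallel edges; the nodes of $S$ are in the fixed order $s_1,\dots,s_n$. A $d$-distance matching is a subset $M\subseteq E$ such that every node of $S$ is incident to at most one edge of $M$, and whenever $s_it,s_jt\in M$ with $i\ne j$, $t\in T$, we have $|j-i|\ge d$. -}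

module Defs where

import Level

open import Data.Bool using (Bool; true; false; _∨_; _∧_; if_then_else_)
open import Data.Nat using (ℕ; zero; suc; _≤_; ∣_-_∣; _≤?_)
import Data.Nat as ℕ
open import Data.Fin using (Fin; zero; suc; toℕ)
open import Data.Fin.Properties using (all?) renaming (_≟_ to _≟ᶠ_)
open import Data.Bool.Properties using () renaming (_≟_ to _≟ᵇ_)
open import Data.List using (List; foldl; allFin; map)
open import Data.Nat.ListAction using (sum)
open import Data.Maybe using (Maybe; just; nothing)
import Data.Maybe as Maybe
open import Data.Product using (_×_)
open import Relation.Nullary using (Dec; yes; no; ¬_; ⌊_⌋)
open import Relation.Nullary.Decidable using (_×-dec_; _→-dec_; ¬?)
open import Relation.Unary using (Pred; Decidable)
open import Relation.Binary.PropositionalEquality using (_≡_; _≢_)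

-- A bipartite graph G = (S, T; E) with S = {s_0,…,s_{n-1}} (in this order,
-- node s_i is  i : Fin n) and T = {t_0,…,t_{k-1}}.  A set of edges between
-- S and T (in particular E itself) is given by its indicator function;
-- simple graph: no loops/parallel edges automatically.
EdgeSet : ℕ → ℕ → Set
EdgeSet n k = Fin n → Fin k → Bool

_⊆ᴱ_ : ∀ {n k} → EdgeSet n k → EdgeSet n k → Set
M ⊆ᴱ E = ∀ i j → M i j ≡ true → E i j ≡ true

IsDistanceMatching : ∀ {n k} → EdgeSet n k → ℕ → EdgeSet n k → Set
IsDistanceMatching {n} {k} E d M =
  M ⊆ᴱ E
  × (∀ (i : Fin n) (j j′ : Fin k) → M i j ≡ true → M i j′ ≡ true → j ≡ j′)
  × (∀ (i i′ : Fin n) (j : Fin k) → M i j ≡ true → M i′ j ≡ true → i ≢ i′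
       → d ≤ ∣ toℕ i - toℕ i′ ∣)

card : ∀ {n k} → EdgeSet n k → ℕ
card {n} {k} M = sum (map (λ i → sum (map (λ j → if M i j then 1 else 0) (allFin k))) (allFin n))

∅ᴱ : ∀ {n k} → EdgeSet n k
∅ᴱ i j = false

insert : ∀ {n k} → EdgeSet n k → Fin n → Fin k → EdgeSet n k
insert M i j i′ j′ = M i′ j′ ∨ (⌊ i′ ≟ᶠ i ⌋ ∧ ⌊ j′ ≟ᶠ j ⌋)

isDistanceMatching? : ∀ {n k} (E : EdgeSet n k) (d : ℕ) (M : EdgeSet n k)
  → Dec (IsDistanceMatching E d M)
isDistanceMatching? E d M =
  all? (λ i → all? (λ j → (M i j ≟ᵇ true) →-dec (E i j ≟ᵇ true)))
  ×-dec all? (λ i → all? (λ j → all? (λ j′ →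
          (M i j ≟ᵇ true) →-dec ((M i j′ ≟ᵇ true) →-dec (j ≟ᶠ j′)))))
  ×-dec all? (λ i → all? (λ i′ → all? (λ j →
          (M i j ≟ᵇ true) →-dec ((M i′ j ≟ᵇ true) →-dec
            ((¬? (i ≟ᶠ i′)) →-dec (d ≤? ∣ toℕ i - toℕ i′ ∣))))))

firstFin : ∀ {k} {P : Pred (Fin k) Level.zero} → Decidable P → Maybe (Fin k)
firstFin {zero} P? = nothing
firstFin {suc k} P? with P? zero
... | yes _ = just zero
... | no _ = Maybe.map suc (firstFin (λ j → P? (suc j)))

greedyStep : ∀ {n k} → EdgeSet n k → ℕ → EdgeSet n k → Fin n → EdgeSet n k
greedyStep E d M i
  with firstFin (λ j → (E i j ≟ᵇ true) ×-dec isDistanceMatching? E d (insert M i j))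
... | just j = insert M i j
... | nothing = M

sGreedy : ∀ {n k} → EdgeSet n k → ℕ → EdgeSet n k
sGreedy {n} E d = foldl (greedyStep E d) ∅ᴱ (allFin n)

-- After s_0, …, s_{p-1} have been processed, the greedy M is a d-distance matching on these
-- nodes, and every edge s_a t_j at an unmatched processed node is blocked: some s_{a′} t_j ∈ M
-- with a − d < a′ < a (otherwise the greedy would have taken an edge at s_a).  For any
-- d-distance matching M*, send each node matched by M* but not by M to such a blocker of its
-- M*-edge.  Two nodes sent to the same s_{a′} use the same t_j (M is a matching) and both lie in
-- the window (a′, a′ + d), so M* cannot contain both; hence |M*| ≤ |M| + |M|.
module Submission where

open import Defs
open import Data.Nat using (ℕ; _≤_; _*_)
open import Data.Product using (_×_)

open import Algebra.Properties.CommutativeSemigroup using (interchange)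
open import Data.Bool using (Bool; true; false; if_then_else_)
open import Data.Bool.Properties using () renaming (_≟_ to _≟ᵇ_)
open import Data.Fin using (Fin; zero; suc; toℕ)
open import Data.Fin.Properties using (any?; toℕ<n; toℕ-injective) renaming (_≟_ to _≟ᶠ_)
open import Data.List using (List; []; _∷_; map; allFin; tabulate; foldl; filter; length)
open import Data.List.Membership.Propositional using (_∈_)
open import Data.List.Membership.Propositional.Properties using (∈-filter⁺; ∈-filter⁻; ∈-allFin)
open import Data.List.Properties using (length-removeAt′)
open import Data.List.Relation.Unary.All as All using ()
open import Data.List.Relation.Unary.AllPairs using (_∷_)
open import Data.List.Relation.Unary.Any using (here; there; _─_)
open import Data.List.Relation.Unary.Unique.Propositional using (Unique)
import Data.List.Relation.Unary.Unique.Propositional.Properties as Unique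
open import Data.Maybe using (just; nothing)
open import Data.Nat using (zero; suc; _+_; _∸_; _<_; ∣_-_∣; z≤n; s≤s; _<?_)
open import Data.Nat.ListAction using (sum)
open import Data.Nat.Properties
open import Data.Product using (∃-syntax; _,_)
open import Data.Sum using (_⊎_; inj₁; inj₂)
open import Level using (0ℓ)
open import Function using (id; _∘_)
open import Relation.Nullary using (Dec; yes; no; ¬_; does; contradiction)
open import Relation.Nullary.Decidable using (_×-dec_; ¬?)
open import Relation.Unary using (Pred; Decidable)
open import Relation.Binary.PropositionalEquality using (_≡_; _≢_; refl; sym; trans; cong; subst)

module _ {A : Set} where

  count : (A → Bool) → List A → ℕ
  count f xs = sum (map (λ x → if f x then 1 else 0) xs)

  count≡0 : (f : A → Bool) (xs : List A) → (∀ {x} → x ∈ xs → f x ≢ true) → count f xs ≡ 0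
  count≡0 f []       none = refl
  count≡0 f (x ∷ xs) none with f x in fx
  ... | true  = contradiction fx (none (here refl))
  ... | false = count≡0 f xs (none ∘ there)

  1≤count : (f : A → Bool) {xs : List A} {x : A} → x ∈ xs → f x ≡ true → 1 ≤ count f xs
  1≤count f {y ∷ xs} (here refl) fx rewrite fx = s≤s z≤n
  1≤count f {y ∷ xs} (there x∈xs) fx = ≤-trans (1≤count f x∈xs fx) (m≤n+m _ _)

  count≤1 : (f : A → Bool) {xs : List A} → Unique xs
          → (∀ x y → f x ≡ true → f y ≡ true → x ≡ y) → count f xs ≤ 1
  count≤1 f {[]}     _            at-most-one = z≤n
  count≤1 f {x ∷ xs} (x∉xs ∷ uxs) at-most-one with f x in fx
  ... | false = count≤1 f uxs at-most-one
  ... | true  = ≤-reflexive (cong suc (count≡0 f xs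
        λ y∈xs fy → All.lookup x∉xs y∈xs (at-most-one _ _ fx fy)))

  length-filter≡count : {P : Pred A 0ℓ} (P? : Decidable P) (xs : List A)
                      → length (filter P? xs) ≡ count (does ∘ P?) xs
  length-filter≡count P? []       = refl
  length-filter≡count P? (x ∷ xs) with P? x
  ... | yes _ = cong suc (length-filter≡count P? xs)
  ... | no  _ = length-filter≡count P? xs

  sum-map-mono : {f g : A → ℕ} (xs : List A) → (∀ x → f x ≤ g x) → sum (map f xs) ≤ sum (map g xs)
  sum-map-mono []       f≤g = z≤n
  sum-map-mono (x ∷ xs) f≤g = +-mono-≤ (f≤g x) (sum-map-mono xs f≤g)

  sum-map-+ : (f g : A → ℕ) (xs : List A)
            → sum (map (λ x → f x + g x) xs) ≡ sum (map f xs) + sum (map g xs)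
  sum-map-+ f g []       = refl
  sum-map-+ f g (x ∷ xs) rewrite sum-map-+ f g xs = interchange +-commutativeSemigroup (f x) (g x) _ _

module _ {B : Set} where

  ∈-─ : {y z : B} {ys : List B} (y∈ys : y ∈ ys) → z ∈ ys → z ≢ y → z ∈ (ys ─ y∈ys)
  ∈-─ (here refl)  (here refl)  z≢y = contradiction refl z≢y
  ∈-─ (here refl)  (there z∈ys) z≢y = z∈ys
  ∈-─ (there _)    (here z≡y)   z≢y = here z≡y
  ∈-─ (there y∈ys) (there z∈ys) z≢y = there (∈-─ y∈ys z∈ys z≢y)

length-≤-of-injective : {A B : Set} (R : A → B → Set) {xs : List A} {ys : List B} → Unique xs
  → (∀ {x} → x ∈ xs → ∃[ y ] y ∈ ys × R x y)
  → (∀ {x x′ y} → x ∈ xs → x′ ∈ xs → R x y → R x′ y → x ≡ x′)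
  → length xs ≤ length ys
length-≤-of-injective R {[]} _ _ _ = z≤n
length-≤-of-injective R {x ∷ xs} {ys} (x∉xs ∷ uxs) image injective
  with y , y∈ys , Rxy ← image (here refl) =
  subst (suc (length xs) ≤_) (sym (length-removeAt′ ys _))
    (s≤s (length-≤-of-injective R uxs image′ (λ p q → injective (there p) (there q))))
  where
  image′ : ∀ {x′} → x′ ∈ xs → ∃[ y′ ] y′ ∈ (ys ─ y∈ys) × R x′ y′
  image′ x′∈xs with y′ , y′∈ys , Rx′y′ ← image (there x′∈xs) =
    y′ , ∈-─ y∈ys y′∈ys y′≢y , Rx′y′
    where
    y′≢y : y′ ≢ y
    y′≢y refl = All.lookup x∉xs x′∈xs (injective (here refl) (there x′∈xs) Rxy Rx′y′)

window-∣-∣< : ∀ {a b c d} → c < a → a ∸ c < d → c < b → b ∸ c < d → ∣ a - b ∣ < d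
window-∣-∣< {a} {b} {c} c<a a∸c<d c<b b∸c<d with ≤-total a b
... | inj₁ a≤b = begin-strict
  ∣ a - b ∣ ≡⟨ m≤n⇒∣m-n∣≡n∸m a≤b ⟩
  b ∸ a     <⟨ ∸-monoʳ-< c<a a≤b ⟩
  b ∸ c     <⟨ b∸c<d ⟩
  _         ∎
  where open ≤-Reasoning
... | inj₂ b≤a = begin-strict
  ∣ a - b ∣ ≡⟨ m≤n⇒∣n-m∣≡n∸m b≤a ⟩
  a ∸ b     <⟨ ∸-monoʳ-< c<b b≤a ⟩
  a ∸ c     <⟨ a∸c<d ⟩
  _         ∎
  where open ≤-Reasoning

firstFin-just : ∀ {k} {P : Pred (Fin k) 0ℓ} (P? : Decidable P) {j} → firstFin P? ≡ just j → P j
firstFin-just {suc k} P? eq with P? zero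
firstFin-just {suc k} P? refl | yes p = p
... | no _ with firstFin (P? ∘ suc) in found
firstFin-just {suc k} P? refl | no _ | just j = firstFin-just (P? ∘ suc) found

firstFin-nothing : ∀ {k} {P : Pred (Fin k) 0ℓ} (P? : Decidable P) → firstFin P? ≡ nothing → ∀ j → ¬ P j
firstFin-nothing {suc k} P? eq j pj with P? zero
firstFin-nothing {suc k} P? () j pj | yes _
... | no ¬p0 with firstFin (P? ∘ suc) in none | j
firstFin-nothing {suc k} P? eq j pj | no ¬p0 | nothing | zero  = ¬p0 pj
firstFin-nothing {suc k} P? eq j pj | no ¬p0 | nothing | suc j′ = firstFin-nothing (P? ∘ suc) none j′ pj

module _ {n k : ℕ} where

  Matched : EdgeSet n k → Fin n → Set
  Matched M a = ∃[ j ] M a j ≡ true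

  matched? : (M : EdgeSet n k) → Decidable (Matched M)
  matched? M a = any? (λ j → M a j ≟ᵇ true)

  Matched-mono : {M M′ : EdgeSet n k} → M ⊆ᴱ M′ → ∀ {a} → Matched M a → Matched M′ a
  Matched-mono M⊆M′ (j , Maj) = j , M⊆M′ _ j Maj

  Blocked : ℕ → EdgeSet n k → Fin n → Fin k → Set
  Blocked d M a j = ∃[ a′ ] M a′ j ≡ true × toℕ a′ < toℕ a × toℕ a ∸ toℕ a′ < d

  blocked? : ∀ d M a j → Dec (Blocked d M a j)
  blocked? d M a j = any? λ a′ → (M a′ j ≟ᵇ true) ×-dec (toℕ a′ <? toℕ a) ×-dec (toℕ a ∸ toℕ a′ <? d)

  Blocked-mono : ∀ {d} {M M′ : EdgeSet n k} → M ⊆ᴱ M′ → ∀ {a j} → Blocked d M a j → Blocked d M′ a j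
  Blocked-mono M⊆M′ (a′ , Ma′j , a′<a , a-a′<d) = a′ , M⊆M′ a′ _ Ma′j , a′<a , a-a′<d

  insert-⊇ : ∀ (M : EdgeSet n k) i j → M ⊆ᴱ insert M i j
  insert-⊇ M i j a b Mab rewrite Mab = refl

  insert-new : ∀ (M : EdgeSet n k) i j → insert M i j i j ≡ true
  insert-new M i j with M i j | i ≟ᶠ i | j ≟ᶠ j
  ... | true  | _      | _      = refl
  ... | false | yes _  | yes _  = refl
  ... | false | no i≢i | _      = contradiction refl i≢i
  ... | false | yes _  | no j≢j = contradiction refl j≢j

  insert⁻ : ∀ (M : EdgeSet n k) i j {a b} → insert M i j a b ≡ true → M a b ≡ true ⊎ (a ≡ i × b ≡ j)
  insert⁻ M i j {a} {b} eq with M a b | a ≟ᶠ i | b ≟ᶠ j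
  ... | true  | _        | _        = inj₁ refl
  ... | false | yes refl | yes refl = inj₂ (refl , refl)
  insert⁻ M i j () | false | yes _ | no _
  insert⁻ M i j () | false | no _  | _

  insert-Matched⁻ : ∀ (M : EdgeSet n k) i j {a} → Matched (insert M i j) a → Matched M a ⊎ a ≡ i
  insert-Matched⁻ M i j {a} (b , eq) with insert⁻ M i j {a} {b} eq
  ... | inj₁ Mab          = inj₁ (b , Mab)
  ... | inj₂ (refl , _)   = inj₂ refl

  Uncovered : EdgeSet n k → EdgeSet n k → Fin n → Set
  Uncovered M M* a = ¬ Matched M a × Matched M* a

  uncovered? : (M M* : EdgeSet n k) → Decidable (Uncovered M M*)
  uncovered? M M* a = ¬? (matched? M a) ×-dec matched? M* a

  rowCard : EdgeSet n k → Fin n → ℕ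
  rowCard M a = count (M a) (allFin k)

  Matched⇒1≤rowCard : ∀ M a → Matched M a → 1 ≤ rowCard M a
  Matched⇒1≤rowCard M a (j , Maj) = 1≤count (M a) (∈-allFin j) Maj

  ¬Matched⇒rowCard≡0 : ∀ M a → ¬ Matched M a → rowCard M a ≡ 0
  ¬Matched⇒rowCard≡0 M a a-unmatched = count≡0 (M a) (allFin k) λ {j} _ Maj → a-unmatched (j , Maj)

  #matched≤card : ∀ M → length (filter (matched? M) (allFin n)) ≤ card M
  #matched≤card M = begin
    length (filter (matched? M) (allFin n)) ≡⟨ length-filter≡count (matched? M) (allFin n) ⟩
    count (does ∘ matched? M) (allFin n)    ≤⟨ sum-map-mono (allFin n) indicator≤rowCard ⟩
    card M                                  ∎
    where
    open ≤-Reasoning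
    indicator≤rowCard : ∀ a → (if does (matched? M a) then 1 else 0) ≤ rowCard M a
    indicator≤rowCard a with matched? M a
    ... | yes a-matched = Matched⇒1≤rowCard M a a-matched
    ... | no  _         = z≤n

  card≤card+#uncovered : ∀ M M* → (∀ a → rowCard M* a ≤ 1)
                       → card M* ≤ card M + length (filter (uncovered? M M*) (allFin n))
  card≤card+#uncovered M M* rowCard*≤1 = begin
    card M*
      ≤⟨ sum-map-mono (allFin n) rowCard-bound ⟩
    sum (map (λ a → rowCard M a + (if does (uncovered? M M* a) then 1 else 0)) (allFin n))
      ≡⟨ sum-map-+ (rowCard M) _ (allFin n) ⟩
    card M + count (does ∘ uncovered? M M*) (allFin n)
      ≡⟨ cong (card M +_) (sym (length-filter≡count (uncovered? M M*) (allFin n))) ⟩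
    card M + length (filter (uncovered? M M*) (allFin n))
      ∎
    where
    open ≤-Reasoning
    rowCard-bound : ∀ a → rowCard M* a ≤ rowCard M a + (if does (uncovered? M M* a) then 1 else 0)
    rowCard-bound a with matched? M a | matched? M* a
    ... | yes a-matched | _ =
      ≤-trans (rowCard*≤1 a) (≤-trans (Matched⇒1≤rowCard M a a-matched) (m≤m+n _ 0))
    ... | no _ | yes _ = ≤-trans (rowCard*≤1 a) (m≤n+m 1 (rowCard M a))
    ... | no _ | no unmatched* = subst (_≤ _) (sym (¬Matched⇒rowCard≡0 M* a unmatched*)) z≤n

module _ {n k : ℕ} (E : EdgeSet n k) (d : ℕ) where

  unblocked⇒far : ∀ {M : EdgeSet n k} {i j} → (∀ a → toℕ i ≤ toℕ a → ¬ Matched M a) → ¬ Blocked d M i j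
                → ∀ a → M a j ≡ true → d ≤ ∣ toℕ i - toℕ a ∣
  unblocked⇒far {M} {i} {j} later-unmatched unblocked a Maj with toℕ i ≤? toℕ a
  ... | yes i≤a = contradiction (j , Maj) (later-unmatched a i≤a)
  ... | no  i≰a with toℕ i ∸ toℕ a <? d
  ...   | yes close = contradiction (a , Maj , ≰⇒> i≰a , close) unblocked
  ...   | no  ¬close = subst (d ≤_) (sym (m≤n⇒∣n-m∣≡n∸m (<⇒≤ (≰⇒> i≰a)))) (≮⇒≥ ¬close)

  insert-isDistanceMatching : ∀ {M i j} → IsDistanceMatching E d M → ¬ Matched M i → E i j ≡ true
    → (∀ a → M a j ≡ true → d ≤ ∣ toℕ i - toℕ a ∣) → IsDistanceMatching E d (insert M i j)
  insert-isDistanceMatching {M} {i} {j} (M⊆E , rows-unique , columns-spread) i-unmatched Eij far =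
    M′⊆E , rows-unique′ , columns-spread′
    where
    M′⊆E : insert M i j ⊆ᴱ E
    M′⊆E a b eq with insert⁻ M i j eq
    ... | inj₁ Mab           = M⊆E a b Mab
    ... | inj₂ (refl , refl) = Eij

    rows-unique′ : ∀ a b b′ → insert M i j a b ≡ true → insert M i j a b′ ≡ true → b ≡ b′
    rows-unique′ a b b′ eq eq′ with insert⁻ M i j eq | insert⁻ M i j eq′
    ... | inj₁ Mab        | inj₁ Mab′       = rows-unique a b b′ Mab Mab′
    ... | inj₁ Mab        | inj₂ (refl , _) = contradiction (b , Mab) i-unmatched
    ... | inj₂ (refl , _) | inj₁ Mab′       = contradiction (b′ , Mab′) i-unmatched
    ... | inj₂ (_ , refl) | inj₂ (_ , refl) = refl

    columns-spread′ : ∀ a a′ b → insert M i j a b ≡ true → insert M i j a′ b ≡ true → a ≢ a′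
                    → d ≤ ∣ toℕ a - toℕ a′ ∣
    columns-spread′ a a′ b eq eq′ a≢a′ with insert⁻ M i j eq | insert⁻ M i j eq′
    ... | inj₁ Mab           | inj₁ Ma′b          = columns-spread a a′ b Mab Ma′b a≢a′
    ... | inj₁ Mab           | inj₂ (refl , refl) = subst (d ≤_) (∣-∣-comm (toℕ i) (toℕ a)) (far a Mab)
    ... | inj₂ (refl , refl) | inj₁ Ma′b          = far a′ Ma′b
    ... | inj₂ (refl , _)    | inj₂ (refl , _)    = contradiction refl a≢a′

  data GreedyStep (M : EdgeSet n k) (i : Fin n) : EdgeSet n k → Set where
    added   : ∀ j → E i j ≡ true → IsDistanceMatching E d (insert M i j) → GreedyStep M i (insert M i j)
    skipped : (∀ j → E i j ≡ true → ¬ IsDistanceMatching E d (insert M i j)) → GreedyStep M i M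

  greedyStep-view : ∀ M i → GreedyStep M i (greedyStep E d M i)
  greedyStep-view M i
    with firstFin (λ j → (E i j ≟ᵇ true) ×-dec isDistanceMatching? E d (insert M i j)) in found
  ... | just j  = let Eij , dm = firstFin-just _ found in added j Eij dm
  ... | nothing = skipped λ j Eij dm → firstFin-nothing _ found j (Eij , dm)

  record GreedyInvariant (p : ℕ) (M : EdgeSet n k) : Set where
    field
      isDistanceMatching : IsDistanceMatching E d M
      later-unmatched    : ∀ a → p ≤ toℕ a → ¬ Matched M a
      unmatched-blocked  : ∀ a → toℕ a < p → ¬ Matched M a → ∀ j → E a j ≡ true → Blocked d M a j

  ∅-invariant : GreedyInvariant 0 ∅ᴱ
  ∅-invariant = record
    { isDistanceMatching = (λ _ _ ()) , (λ _ _ _ ()) , (λ _ _ _ ())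
    ; later-unmatched    = λ _ _ ()
    ; unmatched-blocked  = λ _ ()
    }

  private
    earlier-or-current : ∀ {p} {a i : Fin n} → toℕ i ≡ p → toℕ a < suc p → toℕ a < p ⊎ a ≡ i
    earlier-or-current i≡p a<1+p with m<1+n⇒m<n∨m≡n a<1+p
    ... | inj₁ a<p = inj₁ a<p
    ... | inj₂ a≡p = inj₂ (toℕ-injective (trans a≡p (sym i≡p)))

  greedyStep-invariant : ∀ {p M i} → toℕ i ≡ p → GreedyInvariant p M
                       → GreedyInvariant (suc p) (greedyStep E d M i)
  greedyStep-invariant {p} {M} {i} i≡p inv with greedyStep E d M i | greedyStep-view M i
  ... | _ | added j Eij dm = record
    { isDistanceMatching = dm
    ; later-unmatched    = later-unmatched′
    ; unmatched-blocked  = unmatched-blocked′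
    }
    where
    open GreedyInvariant inv
    M⊆M′ : M ⊆ᴱ insert M i j
    M⊆M′ = insert-⊇ M i j

    later-unmatched′ : ∀ a → suc p ≤ toℕ a → ¬ Matched (insert M i j) a
    later-unmatched′ a p<a a-matched with insert-Matched⁻ M i j a-matched
    ... | inj₁ a-matched-before = later-unmatched a (<⇒≤ p<a) a-matched-before
    ... | inj₂ refl             = <⇒≢ p<a (sym i≡p)

    unmatched-blocked′ : ∀ a → toℕ a < suc p → ¬ Matched (insert M i j) a
                       → ∀ j′ → E a j′ ≡ true → Blocked d (insert M i j) a j′
    unmatched-blocked′ a a<1+p a-unmatched j′ Eaj′ with earlier-or-current i≡p a<1+p
    ... | inj₁ a<p = Blocked-mono M⊆M′
                       (unmatched-blocked a a<p (a-unmatched ∘ Matched-mono M⊆M′) j′ Eaj′)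
    ... | inj₂ refl = contradiction (j , insert-new M i j) a-unmatched
  ... | _ | skipped stuck = record
    { isDistanceMatching = isDistanceMatching
    ; later-unmatched    = λ a p<a → later-unmatched a (<⇒≤ p<a)
    ; unmatched-blocked  = unmatched-blocked′
    }
    where
    open GreedyInvariant inv

    unmatched-blocked′ : ∀ a → toℕ a < suc p → ¬ Matched M a → ∀ j → E a j ≡ true → Blocked d M a j
    unmatched-blocked′ a a<1+p a-unmatched j Eaj with earlier-or-current i≡p a<1+p
    ... | inj₁ a<p = unmatched-blocked a a<p a-unmatched j Eaj
    ... | inj₂ refl with blocked? d M i j
    ...   | yes blocked = blocked
    ...   | no unblocked = contradiction
              (insert-isDistanceMatching isDistanceMatching a-unmatched Eaj
                (unblocked⇒far (λ a′ i≤a′ → later-unmatched a′ (subst (_≤ toℕ a′) i≡p i≤a′)) unblocked))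
              (stuck j Eaj)

  foldl-greedyStep-invariant : ∀ {p M} m (rows : Fin m → Fin n) → (∀ x → toℕ (rows x) ≡ p + toℕ x)
    → GreedyInvariant p M → GreedyInvariant (p + m) (foldl (greedyStep E d) M (tabulate rows))
  foldl-greedyStep-invariant {p} {M} zero    rows consecutive inv =
    subst (λ q → GreedyInvariant q M) (sym (+-identityʳ p)) inv
  foldl-greedyStep-invariant {p} {M} (suc m) rows consecutive inv =
    subst (λ q → GreedyInvariant q (foldl (greedyStep E d) M (tabulate rows))) (sym (+-suc p m))
      (foldl-greedyStep-invariant m (rows ∘ suc) (λ x → trans (consecutive (suc x)) (+-suc p (toℕ x)))
        (greedyStep-invariant (trans (consecutive zero) (+-identityʳ p)) inv))

  sGreedy-invariant : GreedyInvariant n (sGreedy E d)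
  sGreedy-invariant = foldl-greedyStep-invariant n id (λ _ → refl) ∅-invariant

  rowCard≤1 : ∀ {M} → IsDistanceMatching E d M → ∀ a → rowCard M a ≤ 1
  rowCard≤1 {M} (_ , rows-unique , _) a = count≤1 (M a) (Unique.allFin⁺ k) (rows-unique a)

  UnmatchedBlocked : EdgeSet n k → Set
  UnmatchedBlocked M = ∀ a → ¬ Matched M a → ∀ j → E a j ≡ true → Blocked d M a j

  #uncovered≤#matched : ∀ {M M*} → IsDistanceMatching E d M → UnmatchedBlocked M → IsDistanceMatching E d M*
    → length (filter (uncovered? M M*) (allFin n)) ≤ length (filter (matched? M) (allFin n))
  #uncovered≤#matched {M} {M*} (_ , rows-unique , _) unmatched-blocked (M*⊆E , _ , columns-spread*) =
    length-≤-of-injective BlockedBy (Unique.filter⁺ (uncovered? M M*) (Unique.allFin⁺ n))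
      blocker blocker-injective
    where
    BlockedBy : Fin n → Fin n → Set
    BlockedBy a a′ = ∃[ j ] M* a j ≡ true × M a′ j ≡ true × toℕ a′ < toℕ a × toℕ a ∸ toℕ a′ < d

    blocker : ∀ {a} → a ∈ filter (uncovered? M M*) (allFin n)
            → ∃[ a′ ] a′ ∈ filter (matched? M) (allFin n) × BlockedBy a a′
    blocker {a} a-uncovered
      with _ , a-unmatched , j , M*aj ← ∈-filter⁻ (uncovered? M M*) {xs = allFin n} a-uncovered
      with a′ , Ma′j , a′<a , close ← unmatched-blocked a a-unmatched j (M*⊆E a j M*aj) =
      a′ , ∈-filter⁺ (matched? M) (∈-allFin a′) (j , Ma′j) , j , M*aj , Ma′j , a′<a , close

    blocker-injective : ∀ {a b a′} → a ∈ filter (uncovered? M M*) (allFin n)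
                      → b ∈ filter (uncovered? M M*) (allFin n)
                      → BlockedBy a a′ → BlockedBy b a′ → a ≡ b
    blocker-injective {a} {b} {a′} _ _ (j , M*aj , Ma′j , a′<a , a-close) (j′ , M*bj′ , Ma′j′ , a′<b , b-close)
      with rows-unique a′ j j′ Ma′j Ma′j′
    ... | refl with a ≟ᶠ b
    ...   | yes a≡b = a≡b
    ...   | no  a≢b = contradiction (columns-spread* a b j M*aj M*bj′ a≢b)
                        (<⇒≱ (window-∣-∣< a′<a a-close a′<b b-close))

  unmatchedBlocked⇒2-approximation : ∀ M → IsDistanceMatching E d M → UnmatchedBlocked M
    → ∀ M* → IsDistanceMatching E d M* → card M* ≤ 2 * card M
  unmatchedBlocked⇒2-approximation M dm unmatched-blocked M* dm* = begin
    card M*                                                ≤⟨ card≤card+#uncovered M M* (rowCard≤1 dm*) ⟩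
    card M + length (filter (uncovered? M M*) (allFin n))  ≤⟨ +-monoʳ-≤ (card M) #uncovered≤card ⟩
    card M + card M                                        ≡⟨ cong (card M +_) (sym (+-identityʳ (card M))) ⟩
    2 * card M                                             ∎
    where
    open ≤-Reasoning
    #uncovered≤card : length (filter (uncovered? M M*) (allFin n)) ≤ card M
    #uncovered≤card = ≤-trans (#uncovered≤#matched dm unmatched-blocked dm*) (#matched≤card M)

theorem8 : ∀ {n k} (E : EdgeSet n k) (d : ℕ) → 1 ≤ d
    → IsDistanceMatching E d (sGreedy E d)
    × (∀ (M* : EdgeSet n k) → IsDistanceMatching E d M* → card M* ≤ 2 * card (sGreedy E d))
theorem8 E d _ =
  isDistanceMatching ,
  unmatchedBlocked⇒2-approximation E d (sGreedy E d) isDistanceMatching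
    (λ a → unmatched-blocked a (toℕ<n a))
  where open GreedyInvariant (sGreedy-invariant E d)
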